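{- Every flow formula is preserved under Chu transforms. That is, if $\varphi(\bm{v}^\mathsf{p},\bm{v}^\mathsf{s})$ is a flow formula and $(f,g)$ is a Chu transform from a Chu space $\langle X,r,A\rangle$ to a Chu space $\langle Y,s,B\rangle$, then for all tuples $\bm{x}$ of elements of $X$ and $\bm{b}$ of elements of $B$ (of the appropriate lengths), \[ \langle X,r,A\rangle\models\varphi[\bm{x},g(\bm{b})]\implies\langle Y,s,B\rangle\models\varphi[f(\bm{x}),\bm{b}], \] where $f(\bm{x})$ and $g(\bm{b})$ denote pointwise application.
   Context: A Chu space is a triple $\langle X,r,A\rangle$ with $r\subseteq X\times A$ (elements of $X$ are points, elements of $A$ are states). A Chu transform from $\langle X,r,A\rangle$ to $\langle Y,s,B\rangle$ is a pair of functions $f\colon X\to Y$, $g\colon B\to A$ such that for all $x\in X$, $b\in B$: $\langle x,g(b)\rangle\in r\iff\langle f(x),b\rangle\in s$. A Chu space is viewed as a two-sorted structure (disjoint sorts: points $X$ and states $A$) for the two-sorted language with point variables $v^\mathsf{p}$, state variables $v^\mathsf{s}$ and a binary relation symbol $R$ (between a point and a state) interpreted as $r$. The language $\mathcal{L}^\mathrm{II}_{\infty,\infty}$ has atomic formulas $(v^\mathsf{p}_0=v^\mathsf{p}_1)$, $(v^\mathsf{s}_0=v^\mathsf{s}_1)$, $R(v^\mathsf{p},v^\mathsf{s})$, and is closed under negation, arbitrary (infinitary) conjunctions and disjunctions, and existential and universal quantification over (possibly infinite) tuples of variables of either sort. The flow formulas are defined recursively: $(v^\mathsf{p}_0=v^\mathsf{p}_1)$,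 $\lnot(v^\mathsf{s}_0=v^\mathsf{s}_1)$, $R(v^\mathsf{p},v^\mathsf{s})$, $\lnot R(v^\mathsf{p},v^\mathsf{s})$ are flow formulas; arbitrary infinitary conjunctions and disjunctions of flow formulas are flow formulas; if $\varphi$ is a flow formula then $\exists\bm{v}^\mathsf{p}\varphi$ and $\forall\bm{v}^\mathsf{s}\varphi$ are flow formulas (for tuples $\bm{v}^\mathsf{p}$ of point variables and $\bm{v}^\mathsf{s}$ of state variables). -}

module Defs where

open import Data.Product using (Σ; _×_; _,_)
open import Data.Sum using (_⊎_; [_,_])
open import Relation.Nullary using (¬_)
open import Relation.Binary.PropositionalEquality using (_≡_)
open import Function.Bundles using (_⇔_)
open import Function using (_∘_)

record ChuSpace : Set₁ where
  field
    Pt  : Set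
    St  : Set
    rel : Pt → St → Set

open ChuSpace public

record ChuTransform (C D : ChuSpace) : Set where
  field
    fwd  : Pt C → Pt D
    bwd  : St D → St C
    adj  : ∀ x b → rel C x (bwd b) ⇔ rel D (fwd x) b

open ChuTransform public

-- Infinitary conjunctions/disjunctions over arbitrary index sets I, and
-- quantification over arbitrary (possibly infinite) tuples of fresh
-- variables indexed by T.
data Flow (P S : Set) : Set₁ where
  eqP    : P → P → Flow P S
  neqS   : S → S → Flow P S
  R      : P → S → Flow P S
  notR   : P → S → Flow P S
  ⋀      : (I : Set) → (I → Flow P S) → Flow P S
  ⋁      : (I : Set) → (I → Flow P S) → Flow P S
  ∃ᵖ     : (T : Set) → Flow (P ⊎ T) S → Flow P S
  ∀ˢ     : (T : Set) → Flow P (S ⊎ T) → Flow P S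

_⊨_[_,_] : (C : ChuSpace) {P S : Set} → Flow P S → (P → Pt C) → (S → St C) → Set
C ⊨ eqP p q  [ ρ , σ ] = ρ p ≡ ρ q
C ⊨ neqS a b [ ρ , σ ] = ¬ (σ a ≡ σ b)
C ⊨ R p a    [ ρ , σ ] = rel C (ρ p) (σ a)
C ⊨ notR p a [ ρ , σ ] = ¬ rel C (ρ p) (σ a)
C ⊨ ⋀ I φ    [ ρ , σ ] = (i : I) → C ⊨ φ i [ ρ , σ ]
C ⊨ ⋁ I φ    [ ρ , σ ] = Σ I (λ i → C ⊨ φ i [ ρ , σ ])
C ⊨ ∃ᵖ T φ   [ ρ , σ ] = Σ (T → Pt C) (λ xs → C ⊨ φ [ [ ρ , xs ] , σ ])
C ⊨ ∀ˢ T φ   [ ρ , σ ] = (as : T → St C) → C ⊨ φ [ ρ , [ σ , as ] ]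

{-# OPTIONS --safe #-}
module Submission where

open import Defs
open import Function using (_∘_)
open import Function.Bundles using (Equivalence)
open import Data.Product using (_,_)
open import Data.Sum using ([_,_])
open import Data.Sum.Properties using ([,]-∘; [,]-cong)
open import Relation.Binary.PropositionalEquality
  using (_≗_; refl; sym; trans; cong; subst₂)

-- Adjointness of (fwd, bwd) carries R and ¬ R across, and
-- the quantifiers go through because a point witnessing ∃ᵖ in C can be pushed
-- forward by fwd while a state for ∀ˢ in D can be pulled back by bwd: this is
-- why flow formulas quantify only existentially over points and universally
-- over states.

-- Needed because fwd t ∘ [ xs , ys ] and [ fwd t ∘ xs , fwd t ∘ ys ] agree
-- only pointwise.
⊨-resp-≗ : {P S : Set} (C : ChuSpace) (φ : Flow P S)
           {ρ ρ′ : P → Pt C} {σ σ′ : S → St C} → ρ ≗ ρ′ → σ ≗ σ′ →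
           C ⊨ φ [ ρ , σ ] → C ⊨ φ [ ρ′ , σ′ ]
⊨-resp-≗ C (eqP p q)  ρ≗ σ≗ h   = trans (sym (ρ≗ p)) (trans h (ρ≗ q))
⊨-resp-≗ C (neqS a b) ρ≗ σ≗ h e = h (trans (σ≗ a) (trans e (sym (σ≗ b))))
⊨-resp-≗ C (R p a)    ρ≗ σ≗ h   = subst₂ (rel C) (ρ≗ p) (σ≗ a) h
⊨-resp-≗ C (notR p a) ρ≗ σ≗ h k = h (subst₂ (rel C) (sym (ρ≗ p)) (sym (σ≗ a)) k)
⊨-resp-≗ C (⋀ I φ)    ρ≗ σ≗ h i = ⊨-resp-≗ C (φ i) ρ≗ σ≗ (h i)
⊨-resp-≗ C (⋁ I φ)    ρ≗ σ≗ (i , h) = i , ⊨-resp-≗ C (φ i) ρ≗ σ≗ h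
⊨-resp-≗ C (∃ᵖ T φ)   ρ≗ σ≗ (xs , h) =
  xs , ⊨-resp-≗ C φ ([,]-cong ρ≗ (λ _ → refl)) σ≗ h
⊨-resp-≗ C (∀ˢ T φ)   ρ≗ σ≗ h as =
  ⊨-resp-≗ C φ ρ≗ ([,]-cong σ≗ (λ _ → refl)) (h as)

proposition3p5 : {P S : Set} (φ : Flow P S) (C D : ChuSpace) (t : ChuTransform C D)
                 (xs : P → Pt C) (bs : S → St D) →
                 C ⊨ φ [ xs , bwd t ∘ bs ] → D ⊨ φ [ fwd t ∘ xs , bs ]
proposition3p5 (eqP p q)  C D t xs bs h   = cong (fwd t) h
proposition3p5 (neqS a b) C D t xs bs h e = h (cong (bwd t) e)
proposition3p5 (R p a)    C D t xs bs h   = Equivalence.to (adj t (xs p) (bs a)) h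
proposition3p5 (notR p a) C D t xs bs h k = h (Equivalence.from (adj t (xs p) (bs a)) k)
proposition3p5 (⋀ I φ)    C D t xs bs h i = proposition3p5 (φ i) C D t xs bs (h i)
proposition3p5 (⋁ I φ)    C D t xs bs (i , h) = i , proposition3p5 (φ i) C D t xs bs h
proposition3p5 (∃ᵖ T φ)   C D t xs bs (ys , h) =
  fwd t ∘ ys , ⊨-resp-≗ D φ ([,]-∘ (fwd t)) (λ _ → refl)
                 (proposition3p5 φ C D t [ xs , ys ] bs h)
proposition3p5 (∀ˢ T φ)   C D t xs bs h as =
  proposition3p5 φ C D t xs [ bs , as ]
    (⊨-resp-≗ C φ (λ _ → refl) (sym ∘ [,]-∘ (bwd t)) (h (bwd t ∘ as)))
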